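{- The patterns $10$, $001$, $010$, $011$ and $012$ are Wilf equivalent on ascent sequences, i.e., for every $n\ge1$ the number of ascent sequences of length $n$ avoiding each of these patterns is the same.
   Context: An ascent sequence is a finite sequence $x_1x_2\ldots x_n$ of nonnegative integers with $x_1=0$ and $x_i\le \operatorname{asc}(x_1\ldots x_{i-1})+1$ for all $1<i\le n$, where $\operatorname{asc}(y_1\ldots y_k)$ is the number of indices $j$ with $y_j<y_{j+1}$. A pattern is a finite word over the nonnegative integers. An occurrence of a pattern $p=p_1\ldots p_k$ in a sequence $x_1\ldots x_n$ is a subsequence $x_{i_1}\ldots x_{i_k}$, $i_1<\cdots<i_k$, such that for all $a,b$: $x_{i_a}<x_{i_b}$ iff $p_a<p_b$ and $x_{i_a}=x_{i_b}$ iff $p_a=p_b$. A sequence avoids $p$ if it has no occurrence of $p$. Two patterns are Wilf equivalent if for every $n$ the numbers of ascent sequences of length $n$ avoiding them coincide. -}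

module Defs where

open import Data.Nat using (ℕ; _≤_; zero; suc; _+_; _<ᵇ_; _≡ᵇ_; _≤ᵇ_)
open import Data.Bool using (Bool; true; false; _∧_; _∨_; not; if_then_else_)
open import Data.List using (List; []; _∷_; length; filter; map; concatMap; upTo)
open import Data.Bool.ListAction using (all; any)
open import Data.Product using (_×_; _,_)
open import Relation.Nullary.Decidable using (Dec)
open import Data.Bool.Properties using () renaming (_≟_ to _≟B_)
open import Relation.Binary.PropositionalEquality using (_≡_)

asc : List ℕ → ℕ
asc [] = 0
asc (y ∷ []) = 0
asc (y ∷ z ∷ ys) = (if y <ᵇ z then 1 else 0) + asc (z ∷ ys)

snoc : List ℕ → ℕ → List ℕ
snoc [] a = a ∷ []
snoc (x ∷ xs) a = x ∷ snoc xs a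

isAscentFrom : List ℕ → List ℕ → Bool
isAscentFrom pre [] = true
isAscentFrom pre (x ∷ xs) = (x ≤ᵇ suc (asc pre)) ∧ isAscentFrom (snoc pre x) xs

isAscentSeq : List ℕ → Bool
isAscentSeq [] = true
isAscentSeq (x ∷ xs) = (x ≡ᵇ 0) ∧ isAscentFrom (x ∷ []) xs

subseqs : List ℕ → List (List ℕ)
subseqs [] = [] ∷ []
subseqs (x ∷ xs) = let r = subseqs xs in map (x ∷_) r Data.List.++ r

pairs : {A : Set} → List A → List (A × A)
pairs xs = concatMap (λ a → map (λ b → (a , b)) xs) xs

zipL : List ℕ → List ℕ → List (ℕ × ℕ)
zipL [] _ = []
zipL _ [] = []
zipL (a ∷ as) (b ∷ bs) = (a , b) ∷ zipL as bs

orderIso : List ℕ → List ℕ → Bool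
orderIso s p = (length s ≡ᵇ length p) ∧
  all (λ { ((sa , pa) , (sb , pb)) →
           ((sa <ᵇ sb) ≡B (pa <ᵇ pb)) ∧ ((sa ≡ᵇ sb) ≡B (pa ≡ᵇ pb)) })
      (pairs (zipL s p))
  where
  _≡B_ : Bool → Bool → Bool
  true ≡B b = b
  false ≡B b = not b

contains : List ℕ → List ℕ → Bool
contains p x = any (λ s → orderIso s p) (subseqs x)

avoids : List ℕ → List ℕ → Bool
avoids p x = not (contains p x)

words : ℕ → ℕ → List (List ℕ)
words m zero = [] ∷ []
words m (suc n) = concatMap (λ a → map (a ∷_) (words m n)) (upTo m)

-- ascent sequences of length n: entries of an ascent sequence of length n
-- are at most n-1 (x_i ≤ i-1), so they all occur among words n n
ascentSeqs : ℕ → List (List ℕ)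
ascentSeqs n = filter (λ x → isAscentSeq x Data.Bool.≟ true) (words n n)

numAvoiding : List ℕ → ℕ → ℕ
numAvoiding p n = length (filter (λ x → avoids p x Data.Bool.≟ true) (ascentSeqs n))

WilfEquiv : List ℕ → List ℕ → Set
WilfEquiv p q = ∀ n → 1 ≤ n → numAvoiding p n ≡ numAvoiding q n

module Submission where

-- We prove the stronger statement that for each of them
-- exactly 2^(n-1) ascent sequences of length n avoid it.
--
-- An ascent sequence is read letter by letter.  After a prefix 0 r, the letters
-- a that keep the prefix an ascent sequence avoiding p are the "admissible" ones,
-- and the number of avoiding continuations of length j satisfies an obvious sum
-- rule over them (extensions-step).  A "counting scheme" attaches to prefixes an
-- abstract state, an invariant describing the prefix in terms of its state, and
-- a predicted number N j s of continuations; if the predictions obey the same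
-- sum rule, they are the true counts (scheme-count).  We build one scheme per
-- pattern: for 10, 010, 012 and 011 exactly two letters are admissible after
-- every prefix (so N j s = 2^j); for 001 a prefix is either repetition-free
-- (letters 0 … k+1 admissible) or has a repetition, after which it must be
-- weakly decreasing, and the resulting counts still sum to 2^j.

open import Defs
open import Data.List using (List; []; _∷_; length; filter; map; concatMap; applyUpTo; _++_)
open import Data.List.Properties using (++-identityʳ; ∷-injectiveʳ)
open import Data.Product using (_×_; _,_; Σ; proj₁; proj₂)
open import Data.Sum using (_⊎_; inj₁; inj₂)
open import Data.Nat using (ℕ; zero; suc; _+_; _^_; _≤_; _<_; z≤n; s≤s; _<ᵇ_; _≡ᵇ_; _≤ᵇ_)
open import Data.Nat.Properties hiding (_≟_)
open import Data.Bool using (Bool; true; false; _∧_; _∨_; not; if_then_else_; T; _≟_)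
open import Data.Bool.Properties using (∨-assoc; ∨-zeroʳ; ∧-zeroʳ; ∧-conicalˡ; ∧-conicalʳ; T-≡; T-not-≡)
open import Function.Bundles using (Equivalence)
open import Data.Bool.ListAction using (any)
open import Data.Unit using (tt; ⊤)
open import Data.Empty using (⊥; ⊥-elim)
open import Relation.Binary.PropositionalEquality
open import Relation.Binary.Definitions using (tri<; tri≈; tri>)
open import Relation.Nullary using (yes; no)
open import Algebra.Properties.CommutativeSemigroup +-commutativeSemigroup using (interchange)

T⇒≡true : ∀ {b} → T b → b ≡ true
T⇒≡true = Equivalence.to T-≡

≡true⇒T : ∀ {b} → b ≡ true → T b
≡true⇒T = Equivalence.from T-≡

∧-intro : ∀ {a b} → a ≡ true → b ≡ true → a ∧ b ≡ true
∧-intro refl refl = refl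

true≢false : true ≢ false
true≢false ()

not-true : ∀ {b} → not b ≡ true → b ≡ false
not-true h = Equivalence.to T-not-≡ (≡true⇒T h)

≡ᵇ-refl : ∀ n → (n ≡ᵇ n) ≡ true
≡ᵇ-refl n = T⇒≡true (≡⇒≡ᵇ n n refl)

<ᵇ-true : ∀ {m n} → m < n → (m <ᵇ n) ≡ true
<ᵇ-true m<n = T⇒≡true (<⇒<ᵇ m<n)

<ᵇ-false : ∀ {m n} → n ≤ m → (m <ᵇ n) ≡ false
<ᵇ-false {m} {n} n≤m with m <ᵇ n in eq
... | false = refl
... | true = ⊥-elim (<⇒≱ (<ᵇ⇒< m n (≡true⇒T eq)) n≤m)

≡ᵇ-false : ∀ {m n} → m ≢ n → (m ≡ᵇ n) ≡ false
≡ᵇ-false {m} {n} m≢n with m ≡ᵇ n in eq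
... | false = refl
... | true = ⊥-elim (m≢n (≡ᵇ⇒≡ m n (≡true⇒T eq)))

<ᵇ-irrefl : ∀ n → (n <ᵇ n) ≡ false
<ᵇ-irrefl n = <ᵇ-false {n} {n} ≤-refl

<ᵇ-asym : ∀ {m n} → m < n → (n <ᵇ m) ≡ false
<ᵇ-asym m<n = <ᵇ-false (<⇒≤ m<n)

≡ᵇ-<ˡ : ∀ {m n} → m < n → (m ≡ᵇ n) ≡ false
≡ᵇ-<ˡ m<n = ≡ᵇ-false (<⇒≢ m<n)

≡ᵇ-<ʳ : ∀ {m n} → m < n → (n ≡ᵇ m) ≡ false
≡ᵇ-<ʳ m<n = ≡ᵇ-false (≢-sym (<⇒≢ m<n))

≤ᵇ-true : ∀ {m n} → m ≤ n → (m ≤ᵇ n) ≡ true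
≤ᵇ-true m≤n = T⇒≡true (≤⇒≤ᵇ m≤n)

≤ᵇ-sound : ∀ {m n} → (m ≤ᵇ n) ≡ true → m ≤ n
≤ᵇ-sound {m} {n} e = ≤ᵇ⇒≤ m n (≡true⇒T e)

≤ᵇ-false : ∀ {m n} → n < m → (m ≤ᵇ n) ≡ false
≤ᵇ-false {m} {n} n<m with m ≤ᵇ n in eq
... | false = refl
... | true = ⊥-elim (<⇒≱ n<m (≤ᵇ-sound eq))

≤ᵇ-suc : ∀ m n → (suc m ≤ᵇ suc n) ≡ (m ≤ᵇ n)
≤ᵇ-suc zero n = refl
≤ᵇ-suc (suc m) n = refl

≤-between : ∀ {M a} → M ≤ a → a ≤ suc M → (a ≡ M) ⊎ (a ≡ suc M)
≤-between M≤a a≤1+M with m≤n⇒m<n∨m≡n a≤1+M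
... | inj₂ a≡1+M = inj₂ a≡1+M
... | inj₁ (s≤s a≤M) = inj₁ (≤-antisym a≤M M≤a)

σ : (ℕ → ℕ) → ℕ → ℕ
σ f zero = 0
σ f (suc m) = f 0 + σ (λ i → f (suc i)) m

σ-ext : ∀ {f g} m → (∀ i → f i ≡ g i) → σ f m ≡ σ g m
σ-ext zero e = refl
σ-ext (suc m) e = cong₂ _+_ (e 0) (σ-ext m (λ i → e (suc i)))

σ-+ : ∀ f g m → σ (λ i → f i + g i) m ≡ σ f m + σ g m
σ-+ f g zero = refl
σ-+ f g (suc m) = begin
  (f 0 + g 0) + σ (λ i → f (suc i) + g (suc i)) m
    ≡⟨ cong ((f 0 + g 0) +_) (σ-+ (λ i → f (suc i)) (λ i → g (suc i)) m) ⟩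
  (f 0 + g 0) + (σ (λ i → f (suc i)) m + σ (λ i → g (suc i)) m)
    ≡⟨ interchange (f 0) (g 0) _ _ ⟩
  (f 0 + σ (λ i → f (suc i)) m) + (g 0 + σ (λ i → g (suc i)) m) ∎
  where open ≡-Reasoning

σ-zero : ∀ m → σ (λ _ → 0) m ≡ 0
σ-zero zero = refl
σ-zero (suc m) = σ-zero m

σ-snoc : ∀ f m → σ f (suc m) ≡ σ f m + f m
σ-snoc f zero = +-comm (f 0) 0
σ-snoc f (suc m) = trans (cong (f 0 +_) (σ-snoc (λ i → f (suc i)) m)) (sym (+-assoc (f 0) _ _))

σ-point : ∀ u c m → u < m → σ (λ i → if i ≡ᵇ u then c else 0) m ≡ c
σ-point zero c (suc m) _ = trans (cong (c +_) (σ-zero m)) (+-identityʳ c)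
σ-point (suc u) c (suc m) (s≤s u<m) = σ-point u c m u<m

σ-prefix : ∀ f v m → v < m → σ (λ i → if i ≤ᵇ v then f i else 0) m ≡ σ f (suc v)
σ-prefix f zero (suc m) _ = cong (f 0 +_) (σ-zero m)
σ-prefix f (suc v) (suc m) (s≤s v<m) = cong (f 0 +_) (begin
  σ (λ i → if suc i ≤ᵇ suc v then f (suc i) else 0) m
    ≡⟨ σ-ext m (λ i → cong (λ b → if b then f (suc i) else 0) (≤ᵇ-suc i v)) ⟩
  σ (λ i → if i ≤ᵇ v then f (suc i) else 0) m
    ≡⟨ σ-prefix (λ i → f (suc i)) v m v<m ⟩
  σ (λ i → f (suc i)) (suc v) ∎)
  where open ≡-Reasoning

σ-two-points : ∀ (P : ℕ → Bool) c {u w} m → u ≢ w → u < m → w < m →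
  P u ≡ true → P w ≡ true → (∀ a → P a ≡ true → (a ≡ u) ⊎ (a ≡ w)) →
  σ (λ a → if P a then c else 0) m ≡ c + c
σ-two-points P c {u} {w} m u≢w u<m w<m Pu Pw only = begin
  σ (λ a → if P a then c else 0) m
    ≡⟨ σ-ext m split ⟩
  σ (λ a → (if a ≡ᵇ u then c else 0) + (if a ≡ᵇ w then c else 0)) m
    ≡⟨ σ-+ _ _ m ⟩
  σ (λ a → if a ≡ᵇ u then c else 0) m + σ (λ a → if a ≡ᵇ w then c else 0) m
    ≡⟨ cong₂ _+_ (σ-point u c m u<m) (σ-point w c m w<m) ⟩
  c + c ∎
  where
  open ≡-Reasoning
  split : ∀ a → (if P a then c else 0) ≡ (if a ≡ᵇ u then c else 0) + (if a ≡ᵇ w then c else 0)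
  split a with P a in Pa
  ... | true with only a Pa
  ...   | inj₁ refl rewrite ≡ᵇ-refl u | ≡ᵇ-false u≢w = sym (+-identityʳ c)
  ...   | inj₂ refl rewrite ≡ᵇ-refl w | ≡ᵇ-false (≢-sym u≢w) = refl
  split a | false
    rewrite ≡ᵇ-false {a} {u} (λ { refl → true≢false (trans (sym Pu) Pa) })
          | ≡ᵇ-false {a} {w} (λ { refl → true≢false (trans (sym Pw) Pa) }) = refl

cnt : (List ℕ → Bool) → List (List ℕ) → ℕ
cnt f [] = 0
cnt f (x ∷ xs) = (if f x then 1 else 0) + cnt f xs

length-filter : ∀ (f : List ℕ → Bool) L → length (filter (λ x → f x ≟ true) L) ≡ cnt f L
length-filter f [] = refl
length-filter f (x ∷ L) with f x
... | true = cong suc (length-filter f L)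
... | false = length-filter f L

cnt-filter : ∀ (f g : List ℕ → Bool) L →
  cnt g (filter (λ x → f x ≟ true) L) ≡ cnt (λ x → f x ∧ g x) L
cnt-filter f g [] = refl
cnt-filter f g (x ∷ L) with f x
... | true = cong ((if g x then 1 else 0) +_) (cnt-filter f g L)
... | false = cnt-filter f g L

cnt-++ : ∀ f xs ys → cnt f (xs ++ ys) ≡ cnt f xs + cnt f ys
cnt-++ f [] ys = refl
cnt-++ f (x ∷ xs) ys =
  trans (cong ((if f x then 1 else 0) +_) (cnt-++ f xs ys)) (sym (+-assoc _ (cnt f xs) (cnt f ys)))

cnt-map-cons : ∀ f a L → cnt f (map (a ∷_) L) ≡ cnt (λ xs → f (a ∷ xs)) L
cnt-map-cons f a [] = refl
cnt-map-cons f a (x ∷ L) = cong ((if f (a ∷ x) then 1 else 0) +_) (cnt-map-cons f a L)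

cnt-ext : ∀ {f g} L → (∀ x → f x ≡ g x) → cnt f L ≡ cnt g L
cnt-ext [] e = refl
cnt-ext (x ∷ L) e = cong₂ (λ (b : Bool) n → (if b then 1 else 0) + n) (e x) (cnt-ext L e)

cnt-guard : ∀ b g L → cnt (λ x → b ∧ g x) L ≡ (if b then cnt g L else 0)
cnt-guard true g L = refl
cnt-guard false g [] = refl
cnt-guard false g (x ∷ L) = cnt-guard false g L

cnt-concatMap : ∀ f (k : ℕ → List (List ℕ)) (e : ℕ → ℕ) m →
  cnt f (concatMap k (applyUpTo e m)) ≡ σ (λ i → cnt f (k (e i))) m
cnt-concatMap f k e zero = refl
cnt-concatMap f k e (suc m) =
  trans (cnt-++ f (k (e 0)) _) (cong (cnt f (k (e 0)) +_) (cnt-concatMap f k (λ i → e (suc i)) m))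

cnt-words : ∀ f m j → cnt f (words m (suc j)) ≡ σ (λ a → cnt (λ xs → f (a ∷ xs)) (words m j)) m
cnt-words f m j = trans (cnt-concatMap f (λ a → map (a ∷_) (words m j)) (λ i → i) m)
  (σ-ext m (λ a → cnt-map-cons f a (words m j)))

data Sub : List ℕ → List ℕ → Set where
  nil  : Sub [] []
  skip : ∀ {s x} y → Sub s x → Sub s (y ∷ x)
  keep : ∀ {s x} y → Sub s x → Sub (y ∷ s) (y ∷ x)

Elem : ℕ → List ℕ → Set
Elem y x = Sub (y ∷ []) x

sub-nil : ∀ x → Sub [] x
sub-nil [] = nil
sub-nil (y ∷ x) = skip y (sub-nil x)

sub-trans : ∀ {a b c} → Sub a b → Sub b c → Sub a c
sub-trans p nil = p
sub-trans p (skip y q) = skip y (sub-trans p q)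
sub-trans (skip y p) (keep y q) = skip y (sub-trans p q)
sub-trans (keep y p) (keep y q) = keep y (sub-trans p q)

sub-prefix : ∀ x v → Sub x (x ++ v)
sub-prefix [] v = sub-nil v
sub-prefix (y ∷ x) v = keep y (sub-prefix x v)

sub-snoc-skip : ∀ {s x} a → Sub s x → Sub s (snoc x a)
sub-snoc-skip a nil = skip a nil
sub-snoc-skip a (skip y p) = skip y (sub-snoc-skip a p)
sub-snoc-skip a (keep y p) = keep y (sub-snoc-skip a p)

sub-snoc-keep : ∀ {s x} a → Sub s x → Sub (snoc s a) (snoc x a)
sub-snoc-keep a nil = keep a nil
sub-snoc-keep a (skip y p) = skip y (sub-snoc-keep a p)
sub-snoc-keep a (keep y p) = keep y (sub-snoc-keep a p)

sub-snoc-inv : ∀ {s} x a → Sub s (snoc x a) →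
  Sub s x ⊎ Σ (List ℕ) (λ s' → s ≡ snoc s' a × Sub s' x)
sub-snoc-inv [] a (skip .a nil) = inj₁ nil
sub-snoc-inv [] a (keep .a nil) = inj₂ ([] , refl , nil)
sub-snoc-inv (y ∷ x) a (skip .y p) with sub-snoc-inv x a p
... | inj₁ q = inj₁ (skip y q)
... | inj₂ (s' , e , q) = inj₂ (s' , e , skip y q)
sub-snoc-inv (y ∷ x) a (keep .y p) with sub-snoc-inv x a p
... | inj₁ q = inj₁ (keep y q)
... | inj₂ (s' , e , q) = inj₂ (y ∷ s' , cong (y ∷_) e , keep y q)

snoc-nonempty : ∀ t (a : ℕ) → snoc t a ≢ []
snoc-nonempty [] a ()
snoc-nonempty (x ∷ t) a ()

snoc-tail-empty : ∀ {u v a : ℕ} t → u ∷ snoc t a ≢ v ∷ []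
snoc-tail-empty t e = snoc-nonempty t _ (∷-injectiveʳ e)

elem-snoc-inv : ∀ {y} x a → Elem y (snoc x a) → Elem y x ⊎ y ≡ a
elem-snoc-inv x a p with sub-snoc-inv x a p
... | inj₁ q = inj₁ q
... | inj₂ ([] , refl , _) = inj₂ refl
... | inj₂ (u ∷ t , e , _) = ⊥-elim (snoc-tail-empty t (sym e))

pair-snoc-inv : ∀ {y z} x a → Sub (y ∷ z ∷ []) (snoc x a) → Sub (y ∷ z ∷ []) x ⊎ (Elem y x × z ≡ a)
pair-snoc-inv x a p with sub-snoc-inv x a p
... | inj₁ q = inj₁ q
... | inj₂ (u ∷ [] , refl , q) = inj₂ (q , refl)
... | inj₂ (u ∷ v ∷ t , e , q) = ⊥-elim (snoc-tail-empty t (∷-injectiveʳ (sym e)))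

pair-snd : ∀ {y z x} → Sub (y ∷ z ∷ []) x → Elem z x
pair-snd p = sub-trans (skip _ (keep _ nil)) p

pair-fst : ∀ {y z x} → Sub (y ∷ z ∷ []) x → Elem y x
pair-fst p = sub-trans (keep _ (skip _ nil)) p

elem-last : ∀ x a → Elem a (snoc x a)
elem-last x a = sub-snoc-keep a (sub-nil x)

elem-zero : ∀ {y} → Elem y (0 ∷ []) → y ≡ 0
elem-zero (keep .0 nil) = refl

any-++ : ∀ (f : List ℕ → Bool) xs ys → any f (xs ++ ys) ≡ (any f xs ∨ any f ys)
any-++ f [] ys = refl
any-++ f (x ∷ xs) ys = trans (cong (f x ∨_) (any-++ f xs ys)) (sym (∨-assoc (f x) (any f xs) (any f ys)))

any-map-cons : ∀ (f : List ℕ → Bool) (y : ℕ) xs → any f (map (y ∷_) xs) ≡ any (λ s → f (y ∷ s)) xs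
any-map-cons f y [] = refl
any-map-cons f y (x ∷ xs) = cong (f (y ∷ x) ∨_) (any-map-cons f y xs)

∨-trueˡ : ∀ {a b} → a ≡ true → a ∨ b ≡ true
∨-trueˡ refl = refl

∨-trueʳ : ∀ a {b} → b ≡ true → a ∨ b ≡ true
∨-trueʳ a refl = ∨-zeroʳ a

any-sub : ∀ (f : List ℕ → Bool) x → any f (subseqs x) ≡ true → Σ (List ℕ) (λ s → Sub s x × f s ≡ true)
any-sub f [] h with f [] in e
... | true = [] , nil , e
any-sub f (y ∷ x) h rewrite any-++ f (map (y ∷_) (subseqs x)) (subseqs x) | any-map-cons f y (subseqs x)
  with any (λ s → f (y ∷ s)) (subseqs x) in e
... | true with any-sub (λ s → f (y ∷ s)) x e
...   | (s , p , q) = y ∷ s , keep y p , q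
any-sub f (y ∷ x) h | false with any-sub f x h
...   | (s , p , q) = s , skip y p , q

sub-any : ∀ (f : List ℕ → Bool) {s x} → Sub s x → f s ≡ true → any f (subseqs x) ≡ true
sub-any f nil h rewrite h = refl
sub-any f {s} {y ∷ x} (skip y p) h rewrite any-++ f (map (y ∷_) (subseqs x)) (subseqs x) =
  ∨-trueʳ _ (sub-any f p h)
sub-any f {y ∷ s} {y ∷ x} (keep y p) h
  rewrite any-++ f (map (y ∷_) (subseqs x)) (subseqs x) | any-map-cons f y (subseqs x) =
  ∨-trueˡ (sub-any (λ t → f (y ∷ t)) p h)

contains-mono : ∀ p {x y} → Sub x y → contains p x ≡ true → contains p y ≡ true
contains-mono p {x} q h with any-sub (λ s → orderIso s p) x h
... | (s , r , o) = sub-any (λ s → orderIso s p) (sub-trans r q) o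

avoids-prefix : ∀ p x v → avoids p (x ++ v) ≡ true → avoids p x ≡ true
avoids-prefix p x v av with contains p x in e
... | false = refl
... | true = ⊥-elim (true≢false (trans (sym (contains-mono p (sub-prefix x v) e)) (not-true av)))

avoids-snoc : ∀ p x a → avoids p x ≡ true →
  (∀ s' → Sub s' x → orderIso (snoc s' a) p ≡ true → ⊥) → avoids p (snoc x a) ≡ true
avoids-snoc p x a av new with contains p (snoc x a) in e
... | false = refl
... | true with any-sub (λ s → orderIso s p) (snoc x a) e
...   | (s , r , o) with sub-snoc-inv x a r
...     | inj₁ q = ⊥-elim (true≢false (trans (sym (sub-any (λ s → orderIso s p) q o)) (not-true av)))
...     | inj₂ (s' , refl , q) = ⊥-elim (new s' q o)

occurrence-blocks : ∀ p {s' x} a → Sub s' x → orderIso (snoc s' a) p ≡ true →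
  avoids p (snoc x a) ≡ true → ⊥
occurrence-blocks p a q o av =
  true≢false (trans (sym (sub-any (λ s → orderIso s p) (sub-snoc-keep a q) o)) (not-true av))

lastL : ℕ → List ℕ → ℕ
lastL y [] = y
lastL y (z ∷ zs) = lastL z zs

asc-snoc : ∀ y ys a → asc (snoc (y ∷ ys) a) ≡ asc (y ∷ ys) + (if lastL y ys <ᵇ a then 1 else 0)
asc-snoc y [] a = +-comm (if y <ᵇ a then 1 else 0) 0
asc-snoc y (z ∷ zs) a =
  trans (cong ((if y <ᵇ z then 1 else 0) +_) (asc-snoc z zs a))
        (sym (+-assoc (if y <ᵇ z then 1 else 0) (asc (z ∷ zs)) _))

asc-≤-length : ∀ y ys → asc (y ∷ ys) ≤ length ys
asc-≤-length y [] = z≤n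
asc-≤-length y (z ∷ zs) with y <ᵇ z
... | true = s≤s (asc-≤-length z zs)
... | false = m≤n⇒m≤1+n (asc-≤-length z zs)

lastL-snoc : ∀ y ys a → lastL y (snoc ys a) ≡ a
lastL-snoc y [] a = refl
lastL-snoc y (z ∷ zs) a = lastL-snoc z zs a

lastL-elem : ∀ y ys → Elem (lastL y ys) (y ∷ ys)
lastL-elem y [] = keep y nil
lastL-elem y (z ∷ zs) = skip y (lastL-elem z zs)

asc-positive : ∀ y ys → 1 ≤ asc (y ∷ ys) → Σ ℕ (λ w → Elem w ys × 1 ≤ w)
asc-positive y (z ∷ zs) h with y <ᵇ z in e
... | true = z , keep z (sub-nil zs) , ≤-trans (s≤s z≤n) (<ᵇ⇒< y z (≡true⇒T e))
... | false with asc-positive z zs h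
...   | (w , q , r) = w , skip z q , r

length-snoc : ∀ x (a : ℕ) → length (snoc x a) ≡ suc (length x)
length-snoc [] a = refl
length-snoc (y ∷ x) a = cong suc (length-snoc x a)

++-snoc : ∀ r (a : ℕ) xs → r ++ (a ∷ xs) ≡ snoc r a ++ xs
++-snoc [] a xs = refl
++-snoc (y ∷ r) a xs = cong (y ∷_) (++-snoc r a xs)

p10 p001 p010 p011 p012 : List ℕ
p10 = 1 ∷ 0 ∷ []
p001 = 0 ∷ 0 ∷ 1 ∷ []
p010 = 0 ∷ 1 ∷ 0 ∷ []
p011 = 0 ∷ 1 ∷ 1 ∷ []
p012 = 0 ∷ 1 ∷ 2 ∷ []

occurrence-shape₂ : ∀ s' a (q₁ q₂ : ℕ) → orderIso (snoc s' a) (q₁ ∷ q₂ ∷ []) ≡ true →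
  Σ ℕ (λ y → (s' ≡ y ∷ []) × orderIso (y ∷ a ∷ []) (q₁ ∷ q₂ ∷ []) ≡ true)
occurrence-shape₂ [] a q₁ q₂ ()
occurrence-shape₂ (y ∷ []) a q₁ q₂ h = y , refl , h
occurrence-shape₂ (y ∷ z ∷ []) a q₁ q₂ ()
occurrence-shape₂ (y ∷ z ∷ u ∷ t) a q₁ q₂ ()

occurrence-shape₃ : ∀ s' a (q₁ q₂ q₃ : ℕ) → orderIso (snoc s' a) (q₁ ∷ q₂ ∷ q₃ ∷ []) ≡ true →
  Σ ℕ (λ y → Σ ℕ (λ z → (s' ≡ y ∷ z ∷ []) × orderIso (y ∷ z ∷ a ∷ []) (q₁ ∷ q₂ ∷ q₃ ∷ []) ≡ true))
occurrence-shape₃ [] a q₁ q₂ q₃ ()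
occurrence-shape₃ (y ∷ []) a q₁ q₂ q₃ ()
occurrence-shape₃ (y ∷ z ∷ []) a q₁ q₂ q₃ h = y , z , refl , h
occurrence-shape₃ (y ∷ z ∷ u ∷ []) a q₁ q₂ q₃ ()
occurrence-shape₃ (y ∷ z ∷ u ∷ v ∷ t) a q₁ q₂ q₃ ()

iso10-sound : ∀ y a → orderIso (y ∷ a ∷ []) p10 ≡ true → a < y
iso10-sound y a with <-cmp y a
... | tri< y<a _ _ rewrite <ᵇ-true y<a | <ᵇ-irrefl y | ≡ᵇ-refl y = λ ()
... | tri≈ _ refl _ rewrite <ᵇ-irrefl y | ≡ᵇ-refl y = λ ()
... | tri> _ _ a<y = λ _ → a<y

iso10-complete : ∀ y a → a < y → orderIso (y ∷ a ∷ []) p10 ≡ true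
iso10-complete y a a<y
  rewrite <ᵇ-true a<y | <ᵇ-asym a<y | ≡ᵇ-<ˡ a<y | ≡ᵇ-<ʳ a<y
        | <ᵇ-irrefl y | ≡ᵇ-refl y | <ᵇ-irrefl a | ≡ᵇ-refl a = refl

iso001-sound : ∀ y z a → orderIso (y ∷ z ∷ a ∷ []) p001 ≡ true → (y ≡ z) × (z < a)
iso001-sound y z a with <-cmp y z
... | tri< y<z _ _ rewrite <ᵇ-irrefl y | ≡ᵇ-refl y | <ᵇ-true y<z = λ ()
... | tri> _ _ z<y rewrite <ᵇ-irrefl y | ≡ᵇ-refl y | <ᵇ-asym z<y | ≡ᵇ-<ʳ z<y = λ ()
... | tri≈ _ refl _ with <-cmp y a
...   | tri< y<a _ _ = λ _ → refl , y<a
...   | tri≈ _ refl _ rewrite <ᵇ-irrefl y | ≡ᵇ-refl y = λ ()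
...   | tri> _ _ a<y rewrite <ᵇ-irrefl y | ≡ᵇ-refl y | <ᵇ-asym a<y = λ ()

iso001-complete : ∀ y a → y < a → orderIso (y ∷ y ∷ a ∷ []) p001 ≡ true
iso001-complete y a y<a
  rewrite <ᵇ-true y<a | <ᵇ-asym y<a | ≡ᵇ-<ˡ y<a | ≡ᵇ-<ʳ y<a
        | <ᵇ-irrefl y | ≡ᵇ-refl y | <ᵇ-irrefl a | ≡ᵇ-refl a = refl

iso012-sound : ∀ y z a → orderIso (y ∷ z ∷ a ∷ []) p012 ≡ true → (y < z) × (z < a)
iso012-sound y z a with <-cmp y z
... | tri≈ _ refl _ rewrite <ᵇ-irrefl y | ≡ᵇ-refl y = λ ()
... | tri> _ _ z<y rewrite <ᵇ-irrefl y | ≡ᵇ-refl y | <ᵇ-asym z<y = λ ()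
... | tri< y<z _ _ with <-cmp z a
...   | tri< z<a _ _ = λ _ → y<z , z<a
...   | tri≈ _ refl _
  rewrite <ᵇ-true y<z | <ᵇ-asym y<z | ≡ᵇ-<ˡ y<z | ≡ᵇ-<ʳ y<z
        | <ᵇ-irrefl y | ≡ᵇ-refl y | <ᵇ-irrefl z | ≡ᵇ-refl z = λ ()
...   | tri> _ _ a<z with <-cmp y a
...     | tri< y<a _ _
  rewrite <ᵇ-true y<z | <ᵇ-asym y<z | ≡ᵇ-<ˡ y<z | ≡ᵇ-<ʳ y<z
        | <ᵇ-true y<a | ≡ᵇ-<ˡ y<a | <ᵇ-asym a<z
        | <ᵇ-irrefl y | ≡ᵇ-refl y | <ᵇ-irrefl z | ≡ᵇ-refl z = λ ()
...     | tri≈ _ refl _ rewrite <ᵇ-true y<z | ≡ᵇ-<ˡ y<z | <ᵇ-irrefl y | ≡ᵇ-refl y = λ ()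
...     | tri> _ _ a<y rewrite <ᵇ-true y<z | ≡ᵇ-<ˡ y<z | <ᵇ-asym a<y | <ᵇ-irrefl y | ≡ᵇ-refl y = λ ()

iso012-complete : ∀ y z a → y < z → z < a → orderIso (y ∷ z ∷ a ∷ []) p012 ≡ true
iso012-complete y z a y<z z<a
  rewrite <ᵇ-true y<z | <ᵇ-asym y<z | ≡ᵇ-<ˡ y<z | ≡ᵇ-<ʳ y<z
        | <ᵇ-true z<a | <ᵇ-asym z<a | ≡ᵇ-<ˡ z<a | ≡ᵇ-<ʳ z<a
        | <ᵇ-true (<-trans y<z z<a) | <ᵇ-asym (<-trans y<z z<a)
        | ≡ᵇ-<ˡ (<-trans y<z z<a) | ≡ᵇ-<ʳ (<-trans y<z z<a)
        | <ᵇ-irrefl y | ≡ᵇ-refl y | <ᵇ-irrefl z | ≡ᵇ-refl z | <ᵇ-irrefl a | ≡ᵇ-refl a = refl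

iso010-sound : ∀ y z a → orderIso (y ∷ z ∷ a ∷ []) p010 ≡ true → (y < z) × (a ≡ y)
iso010-sound y z a with <-cmp y z
... | tri≈ _ refl _ rewrite <ᵇ-irrefl y | ≡ᵇ-refl y = λ ()
... | tri> _ _ z<y rewrite <ᵇ-irrefl y | ≡ᵇ-refl y | <ᵇ-asym z<y = λ ()
... | tri< y<z _ _ with <-cmp y a
...   | tri≈ _ refl _ = λ _ → y<z , refl
...   | tri< y<a _ _ rewrite <ᵇ-true y<z | ≡ᵇ-<ˡ y<z | <ᵇ-true y<a | <ᵇ-irrefl y | ≡ᵇ-refl y = λ ()
...   | tri> _ _ a<y
  rewrite <ᵇ-true y<z | ≡ᵇ-<ˡ y<z | <ᵇ-asym a<y | ≡ᵇ-<ʳ a<y | <ᵇ-irrefl y | ≡ᵇ-refl y = λ ()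

iso010-complete : ∀ y z → y < z → orderIso (y ∷ z ∷ y ∷ []) p010 ≡ true
iso010-complete y z y<z
  rewrite <ᵇ-true y<z | <ᵇ-asym y<z | ≡ᵇ-<ˡ y<z | ≡ᵇ-<ʳ y<z
        | <ᵇ-irrefl y | ≡ᵇ-refl y | <ᵇ-irrefl z | ≡ᵇ-refl z = refl

iso011-sound : ∀ y z a → orderIso (y ∷ z ∷ a ∷ []) p011 ≡ true → (y < z) × (a ≡ z)
iso011-sound y z a with <-cmp y z
... | tri≈ _ refl _ rewrite <ᵇ-irrefl y | ≡ᵇ-refl y = λ ()
... | tri> _ _ z<y rewrite <ᵇ-irrefl y | ≡ᵇ-refl y | <ᵇ-asym z<y = λ ()
... | tri< y<z _ _ with <-cmp z a
...   | tri≈ _ refl _ = λ _ → y<z , refl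
...   | tri< z<a _ _
  rewrite <ᵇ-true y<z | <ᵇ-asym y<z | ≡ᵇ-<ˡ y<z | ≡ᵇ-<ʳ y<z | <ᵇ-true z<a
        | <ᵇ-true (<-trans y<z z<a) | ≡ᵇ-<ˡ (<-trans y<z z<a)
        | <ᵇ-irrefl y | ≡ᵇ-refl y | <ᵇ-irrefl z | ≡ᵇ-refl z = λ ()
...   | tri> _ _ a<z with <-cmp y a
...     | tri< y<a _ _
  rewrite <ᵇ-true y<z | <ᵇ-asym y<z | ≡ᵇ-<ˡ y<z | ≡ᵇ-<ʳ y<z
        | <ᵇ-true y<a | ≡ᵇ-<ˡ y<a | <ᵇ-asym a<z | ≡ᵇ-<ʳ a<z
        | <ᵇ-irrefl y | ≡ᵇ-refl y | <ᵇ-irrefl z | ≡ᵇ-refl z = λ ()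
...     | tri≈ _ refl _ rewrite <ᵇ-true y<z | ≡ᵇ-<ˡ y<z | <ᵇ-irrefl y | ≡ᵇ-refl y = λ ()
...     | tri> _ _ a<y rewrite <ᵇ-true y<z | ≡ᵇ-<ˡ y<z | <ᵇ-asym a<y | <ᵇ-irrefl y | ≡ᵇ-refl y = λ ()

iso011-complete : ∀ y z → y < z → orderIso (y ∷ z ∷ z ∷ []) p011 ≡ true
iso011-complete y z y<z
  rewrite <ᵇ-true y<z | <ᵇ-asym y<z | ≡ᵇ-<ˡ y<z | ≡ᵇ-<ʳ y<z
        | <ᵇ-irrefl y | ≡ᵇ-refl y | <ᵇ-irrefl z | ≡ᵇ-refl z = refl

extends : List ℕ → List ℕ → List ℕ → Bool
extends p r xs = isAscentFrom (0 ∷ r) xs ∧ avoids p (0 ∷ (r ++ xs))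

admissible : List ℕ → List ℕ → ℕ → Bool
admissible p r a = (a ≤ᵇ suc (asc (0 ∷ r))) ∧ avoids p (0 ∷ snoc r a)

admissible-asc : ∀ p r a → admissible p r a ≡ true → a ≤ suc (asc (0 ∷ r))
admissible-asc p r a h = ≤ᵇ-sound (∧-conicalˡ (a ≤ᵇ suc (asc (0 ∷ r))) _ h)

admissible-avoids : ∀ p r a → admissible p r a ≡ true → avoids p (0 ∷ snoc r a) ≡ true
admissible-avoids p r a h = ∧-conicalʳ (a ≤ᵇ suc (asc (0 ∷ r))) _ h

admissible-intro : ∀ p r a → a ≤ suc (asc (0 ∷ r)) → avoids p (0 ∷ snoc r a) ≡ true →
  admissible p r a ≡ true
admissible-intro p r a a≤ av = ∧-intro (≤ᵇ-true a≤) av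

-- Admissible letters are small, so sums over them can be taken up to any large m.
admissible-bound : ∀ p r a → admissible p r a ≡ true → a ≤ suc (length r)
admissible-bound p r a h = ≤-trans (admissible-asc p r a h) (s≤s (asc-≤-length 0 r))

∧-regroup : ∀ b c d e → (e ≡ true → c ≡ true) → (b ∧ d) ∧ e ≡ (b ∧ c) ∧ (d ∧ e)
∧-regroup false c d e _ = refl
∧-regroup true c false e _ = sym (∧-zeroʳ c)
∧-regroup true c true true e⇒c rewrite e⇒c refl = refl
∧-regroup true c true false _ = sym (∧-zeroʳ c)

-- Reading one more letter: a continuation a xs of 0 r is good iff a is admissible
-- and xs is a good continuation of 0 r a (avoidance is inherited by prefixes).
extends-cons : ∀ p r a xs → extends p r (a ∷ xs) ≡ admissible p r a ∧ extends p (snoc r a) xs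
extends-cons p r a xs rewrite ++-snoc r a xs =
  ∧-regroup (a ≤ᵇ suc (asc (0 ∷ r))) (avoids p (0 ∷ snoc r a)) (isAscentFrom (0 ∷ snoc r a) xs)
            (avoids p (0 ∷ (snoc r a ++ xs))) (avoids-prefix p (0 ∷ snoc r a) xs)

extensions-step : ∀ p r m j → cnt (extends p r) (words m (suc j)) ≡
  σ (λ a → if admissible p r a then cnt (extends p (snoc r a)) (words m j) else 0) m
extensions-step p r m j = trans (cnt-words (extends p r) m j) (σ-ext m (λ a →
  trans (cnt-ext (words m j) (extends-cons p r a))
        (cnt-guard (admissible p r a) (extends p (snoc r a)) (words m j))))

extensions-base : ∀ p r m → avoids p (0 ∷ r) ≡ true → cnt (extends p r) (words m 0) ≡ 1
extensions-base p r m av rewrite ++-identityʳ r | av = refl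

-- Ascent sequences of length j + 1 are 0 followed by a good continuation of the
-- empty prefix (the words starting with a positive letter are not counted).
numAvoiding-extensions : ∀ p j → numAvoiding p (suc j) ≡ cnt (extends p []) (words (suc j) j)
numAvoiding-extensions p j = begin
  numAvoiding p (suc j)
    ≡⟨ length-filter (avoids p) (ascentSeqs (suc j)) ⟩
  cnt (avoids p) (ascentSeqs (suc j))
    ≡⟨ cnt-filter isAscentSeq (avoids p) (words (suc j) (suc j)) ⟩
  cnt (λ x → isAscentSeq x ∧ avoids p x) (words (suc j) (suc j))
    ≡⟨ cnt-words (λ x → isAscentSeq x ∧ avoids p x) (suc j) j ⟩
  cnt (extends p []) (words (suc j) j) + σ (λ i → cnt (λ _ → false) (words (suc j) j)) j
    ≡⟨ cong (cnt (extends p []) (words (suc j) j) +_)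
            (trans (σ-ext j (λ i → cnt-guard false (λ _ → false) (words (suc j) j))) (σ-zero j)) ⟩
  cnt (extends p []) (words (suc j) j) + 0
    ≡⟨ +-identityʳ _ ⟩
  cnt (extends p []) (words (suc j) j) ∎
  where open ≡-Reasoning

-- The only real requirement is that the predictions
-- satisfy the sum rule of extensions-step.

record CountingScheme (p : List ℕ) : Set₁ where
  field
    State      : Set
    Inv        : List ℕ → State → Set
    next       : State → ℕ → State
    N          : ℕ → State → ℕ
    inv-avoids : ∀ {r s} → Inv r s → avoids p (0 ∷ r) ≡ true
    inv-next   : ∀ {r s a} → Inv r s → admissible p r a ≡ true → Inv (snoc r a) (next s a)
    N-zero     : ∀ s → N 0 s ≡ 1
    N-suc      : ∀ {r s} → Inv r s → ∀ j m → suc (suc (length r)) ≤ m →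
                 σ (λ a → if admissible p r a then N j (next s a) else 0) m ≡ N (suc j) s

-- The size bound under which words m j contain all continuations of 0 r, and
-- its two consequences used in the recursion.
room-for-letter : ∀ (r : List ℕ) j {m} → suc (length r) + suc j ≤ m → suc (suc (length r)) ≤ m
room-for-letter r j b =
  ≤-trans (s≤s (s≤s (m≤m+n (length r) j))) (≤-trans (≤-reflexive (sym (+-suc (suc (length r)) j))) b)

room-after-letter : ∀ (r : List ℕ) (a : ℕ) j {m} → suc (length r) + suc j ≤ m → suc (length (snoc r a)) + j ≤ m
room-after-letter r a j {m} b rewrite length-snoc r a = subst (_≤ m) (+-suc (suc (length r)) j) b

module _ {p : List ℕ} (S : CountingScheme p) where
  open CountingScheme S

  scheme-extensions : ∀ j m r s → Inv r s → suc (length r) + j ≤ m →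
    cnt (extends p r) (words m j) ≡ N j s
  scheme-extensions zero m r s inv _ = trans (extensions-base p r m (inv-avoids inv)) (sym (N-zero s))
  scheme-extensions (suc j) m r s inv b = begin
    cnt (extends p r) (words m (suc j))
      ≡⟨ extensions-step p r m j ⟩
    σ (λ a → if admissible p r a then cnt (extends p (snoc r a)) (words m j) else 0) m
      ≡⟨ σ-ext m child ⟩
    σ (λ a → if admissible p r a then N j (next s a) else 0) m
      ≡⟨ N-suc inv j m (room-for-letter r j b) ⟩
    N (suc j) s ∎
    where
    open ≡-Reasoning
    child : ∀ a → (if admissible p r a then cnt (extends p (snoc r a)) (words m j) else 0) ≡
                  (if admissible p r a then N j (next s a) else 0)
    child a with admissible p r a in adm
    ... | true = scheme-extensions j m (snoc r a) (next s a) (inv-next inv adm) (room-after-letter r a j b)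
    ... | false = refl

  scheme-count : ∀ s → Inv [] s → ∀ j → numAvoiding p (suc j) ≡ N j s
  scheme-count s inv j = trans (numAvoiding-extensions p j) (scheme-extensions j (suc j) [] s inv ≤-refl)

doubling : ∀ p r j m {u w} → u ≢ w → admissible p r u ≡ true → admissible p r w ≡ true →
  (∀ a → admissible p r a ≡ true → (a ≡ u) ⊎ (a ≡ w)) → suc (suc (length r)) ≤ m →
  σ (λ a → if admissible p r a then 2 ^ j else 0) m ≡ 2 ^ suc j
doubling p r j m {u} {w} u≢w adm-u adm-w only room =
  trans (σ-two-points (admissible p r) (2 ^ j) m u≢w (below u adm-u) (below w adm-w) adm-u adm-w only)
        (cong (2 ^ j +_) (sym (+-identityʳ (2 ^ j))))
  where
  below : ∀ a → admissible p r a ≡ true → a < m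
  below a adm = ≤-trans (s≤s (admissible-bound p r a adm)) room

-- Patterns 10 and 010.  Their avoiders are "staircases": 0 r is weakly increasing,
-- climbs by one at each ascent, and ends at its maximum M = asc(0 r); every value
-- below M occurs before an M.  After a staircase only M and M + 1 are admissible.

record Staircase (p r : List ℕ) (M : ℕ) : Set where
  field
    asc-max  : asc (0 ∷ r) ≡ M
    bounded  : ∀ y → Elem y (0 ∷ r) → y ≤ M
    last-max : lastL 0 r ≡ M
    below    : ∀ y → y < M → Sub (y ∷ M ∷ []) (0 ∷ r)
    avoiding : avoids p (0 ∷ r) ≡ true
open Staircase

staircase-max-occurs : ∀ {p r M} → Staircase p r M → Elem M (0 ∷ r)
staircase-max-occurs {r = r} st = subst (λ v → Elem v (0 ∷ r)) (last-max st) (lastL-elem 0 r)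

staircase-start : ∀ p → avoids p (0 ∷ []) ≡ true → Staircase p [] 0
staircase-start p av = record
  { asc-max = refl
  ; bounded = λ y q → ≤-reflexive (elem-zero q)
  ; last-max = refl
  ; below = λ y ()
  ; avoiding = av }

staircase-stay : ∀ {p r M} → Staircase p r M → avoids p (0 ∷ snoc r M) ≡ true → Staircase p (snoc r M) M
staircase-stay {p} {r} {M} st av = record
  { asc-max = trans (asc-snoc 0 r M) no-new-ascent
  ; bounded = bnd
  ; last-max = lastL-snoc 0 r M
  ; below = λ y y<M → sub-snoc-skip M (below st y y<M)
  ; avoiding = av }
  where
  no-new-ascent : asc (0 ∷ r) + (if lastL 0 r <ᵇ M then 1 else 0) ≡ M
  no-new-ascent rewrite last-max st | <ᵇ-irrefl M | asc-max st = +-identityʳ M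
  bnd : ∀ y → Elem y (0 ∷ snoc r M) → y ≤ M
  bnd y q with elem-snoc-inv (0 ∷ r) M q
  ... | inj₁ q' = bounded st y q'
  ... | inj₂ refl = ≤-refl

staircase-climb : ∀ {p r M} → Staircase p r M → avoids p (0 ∷ snoc r (suc M)) ≡ true →
  Staircase p (snoc r (suc M)) (suc M)
staircase-climb {p} {r} {M} st av = record
  { asc-max = trans (asc-snoc 0 r (suc M)) new-ascent
  ; bounded = bnd
  ; last-max = lastL-snoc 0 r (suc M)
  ; below = bel
  ; avoiding = av }
  where
  new-ascent : asc (0 ∷ r) + (if lastL 0 r <ᵇ suc M then 1 else 0) ≡ suc M
  new-ascent rewrite last-max st | <ᵇ-true (n<1+n M) | asc-max st = +-comm M 1
  bnd : ∀ y → Elem y (0 ∷ snoc r (suc M)) → y ≤ suc M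
  bnd y q with elem-snoc-inv (0 ∷ r) (suc M) q
  ... | inj₁ q' = m≤n⇒m≤1+n (bounded st y q')
  ... | inj₂ refl = ≤-refl
  bel : ∀ y → y < suc M → Sub (y ∷ suc M ∷ []) (0 ∷ snoc r (suc M))
  bel y (s≤s y≤M) with m≤n⇒m<n∨m≡n y≤M
  ... | inj₁ y<M = sub-snoc-keep (suc M) (pair-fst (below st y y<M))
  ... | inj₂ refl = sub-snoc-keep (suc M) (staircase-max-occurs st)

staircase-admissible-≤ : ∀ {p r M} → Staircase p r M → ∀ a → admissible p r a ≡ true → a ≤ suc M
staircase-admissible-≤ {p} {r} st a adm = subst (λ k → a ≤ suc k) (asc-max st) (admissible-asc p r a adm)

staircase-admissible : ∀ {p r M} → Staircase p r M → ∀ a → a ≤ suc M →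
  (∀ s' → Sub s' (0 ∷ r) → orderIso (snoc s' a) p ≡ true → ⊥) → admissible p r a ≡ true
staircase-admissible {p} {r} st a a≤ no-occurrence =
  admissible-intro p r a (subst (λ k → a ≤ suc k) (sym (asc-max st)) a≤)
    (avoids-snoc p (0 ∷ r) a (avoiding st) no-occurrence)

record StaircaseAdmissibility (p : List ℕ) : Set where
  field
    small-blocked : ∀ {r M} → Staircase p r M → ∀ a → a < M → admissible p r a ≡ true → ⊥
    large-free    : ∀ {r M} → Staircase p r M → ∀ a → M ≤ a → a ≤ suc M → admissible p r a ≡ true

staircase-only : ∀ {p r M} → StaircaseAdmissibility p → Staircase p r M →
  ∀ a → admissible p r a ≡ true → (a ≡ M) ⊎ (a ≡ suc M)
staircase-only {M = M} sa st a adm with <-cmp a M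
... | tri< a<M _ _ = ⊥-elim (StaircaseAdmissibility.small-blocked sa st a a<M adm)
... | tri≈ _ a≡M _ = inj₁ a≡M
... | tri> _ _ M<a = ≤-between (<⇒≤ M<a) (staircase-admissible-≤ st a adm)

staircaseScheme : ∀ p → StaircaseAdmissibility p → CountingScheme p
staircaseScheme p sa = record
  { State = ℕ
  ; Inv = Staircase p
  ; next = λ _ a → a
  ; N = λ j _ → 2 ^ j
  ; inv-avoids = avoiding
  ; inv-next = step
  ; N-zero = λ _ → refl
  ; N-suc = λ {r} {M} st j m room →
      doubling p r j m (λ M≡1+M → <-irrefl M≡1+M (n<1+n M))
        (large-free st M ≤-refl (n≤1+n M)) (large-free st (suc M) (n≤1+n M) ≤-refl)
        (staircase-only sa st) room }
  where
  open StaircaseAdmissibility sa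
  step : ∀ {r M a} → Staircase p r M → admissible p r a ≡ true → Staircase p (snoc r a) a
  step {r} {M} {a} st adm with staircase-only sa st a adm
  ... | inj₁ refl = staircase-stay st (admissible-avoids p r a adm)
  ... | inj₂ refl = staircase-climb st (admissible-avoids p r a adm)

-- 10: a letter a < M forms 10 with the maximum; a letter a ≥ M is above everything.
admissibility10 : StaircaseAdmissibility p10
admissibility10 = record
  { small-blocked = λ {r} st a a<M adm →
      occurrence-blocks p10 a (staircase-max-occurs st) (iso10-complete _ a a<M) (admissible-avoids p10 r a adm)
  ; large-free = λ st a M≤a a≤ → staircase-admissible st a a≤ (no-occurrence st a M≤a) }
  where
  no-occurrence : ∀ {r M} → Staircase p10 r M → ∀ a → M ≤ a →
    ∀ s' → Sub s' (0 ∷ r) → orderIso (snoc s' a) p10 ≡ true → ⊥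
  no-occurrence st a M≤a s' q o with occurrence-shape₂ s' a 1 0 o
  ... | (y , refl , o') = <⇒≱ (iso10-sound y a o') (≤-trans (bounded st y q) M≤a)

-- 010: a letter a < M forms 010 with an earlier a before an M; for a ≥ M the
-- middle letter of an occurrence would exceed M.
admissibility010 : StaircaseAdmissibility p010
admissibility010 = record
  { small-blocked = λ {r} st a a<M adm →
      occurrence-blocks p010 a (below st a a<M) (iso010-complete a _ a<M) (admissible-avoids p010 r a adm)
  ; large-free = λ st a M≤a a≤ → staircase-admissible st a a≤ (no-occurrence st a M≤a) }
  where
  no-occurrence : ∀ {r M} → Staircase p010 r M → ∀ a → M ≤ a →
    ∀ s' → Sub s' (0 ∷ r) → orderIso (snoc s' a) p010 ≡ true → ⊥
  no-occurrence st a M≤a s' q o with occurrence-shape₃ s' a 0 1 0 o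
  ... | (y , z , refl , o') with iso010-sound y z a o'
  ...   | (y<z , refl) = <⇒≱ (<-≤-trans y<z (bounded st z (pair-snd q))) M≤a

-- Pattern 012.  Its avoiders are exactly the 0-1 words starting with 0: a letter
-- a ≥ 2 needs an ascent, hence an earlier 1, and then 0 1 a is an occurrence.

record ZeroOne (r : List ℕ) : Set where
  field
    letters-≤1  : ∀ y → Elem y (0 ∷ r) → y ≤ 1
    avoiding012 : avoids p012 (0 ∷ r) ≡ true
open ZeroOne

zeroOne-free : ∀ {r} → ZeroOne r → ∀ a → a ≤ 1 → admissible p012 r a ≡ true
zeroOne-free {r} zo a a≤1 =
  admissible-intro p012 r a (≤-trans a≤1 (s≤s z≤n)) (avoids-snoc p012 (0 ∷ r) a (avoiding012 zo) no-occurrence)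
  where
  no-occurrence : ∀ s' → Sub s' (0 ∷ r) → orderIso (snoc s' a) p012 ≡ true → ⊥
  no-occurrence s' q o with occurrence-shape₃ s' a 0 1 2 o
  ... | (y , z , refl , o') with iso012-sound y z a o'
  ...   | (y<z , z<a) = <⇒≱ (<-≤-trans y<z (≤-pred (≤-trans z<a a≤1))) z≤n

zeroOne-only : ∀ {r} → ZeroOne r → ∀ a → admissible p012 r a ≡ true → (a ≡ 0) ⊎ (a ≡ 1)
zeroOne-only zo zero _ = inj₁ refl
zeroOne-only zo (suc zero) _ = inj₂ refl
zeroOne-only {r} zo a@(suc (suc _)) adm
  with asc-positive 0 r (≤-pred (≤-trans (s≤s (s≤s z≤n)) (admissible-asc p012 r a adm)))
... | (w , q , 1≤w) with ≤-antisym (letters-≤1 zo w (skip 0 q)) 1≤w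
...   | refl = ⊥-elim (occurrence-blocks p012 a (keep 0 q)
                 (iso012-complete 0 1 a (s≤s z≤n) (s≤s (s≤s z≤n))) (admissible-avoids p012 r a adm))

zeroOne-step : ∀ {r} → ZeroOne r → ∀ a → admissible p012 r a ≡ true → ZeroOne (snoc r a)
zeroOne-step {r} zo a adm = record { letters-≤1 = bnd ; avoiding012 = admissible-avoids p012 r a adm }
  where
  bnd : ∀ y → Elem y (0 ∷ snoc r a) → y ≤ 1
  bnd y q with elem-snoc-inv (0 ∷ r) a q | zeroOne-only zo a adm
  ... | inj₁ q' | _ = letters-≤1 zo y q'
  ... | inj₂ refl | inj₁ refl = z≤n
  ... | inj₂ refl | inj₂ refl = ≤-refl

scheme012 : CountingScheme p012
scheme012 = record
  { State = ⊤
  ; Inv = λ r _ → ZeroOne r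
  ; next = λ _ _ → tt
  ; N = λ j _ → 2 ^ j
  ; inv-avoids = avoiding012
  ; inv-next = λ {r} {_} {a} zo adm → zeroOne-step zo a adm
  ; N-zero = λ _ → refl
  ; N-suc = λ {r} zo j m room →
      doubling p012 r j m (λ ()) (zeroOne-free zo 0 z≤n) (zeroOne-free zo 1 ≤-refl) (zeroOne-only zo) room }

zeroOne-start : ZeroOne []
zeroOne-start = record { letters-≤1 = λ y q → ≤-trans (≤-reflexive (elem-zero q)) z≤n ; avoiding012 = refl }

-- Pattern 011.  Its avoiders are the words in which every letter is 0 or a new
-- maximum: a repeated positive value y would give 0 y y.  With M = asc(0 r) the
-- current maximum, the admissible letters are 0 and M + 1.

record ZeroOrNewMax (r : List ℕ) (M : ℕ) : Set where
  field
    asc-top     : asc (0 ∷ r) ≡ M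
    below-top   : ∀ y → Elem y (0 ∷ r) → y ≤ M
    all-present : ∀ y → 1 ≤ y → y ≤ M → Elem y r
    avoiding011 : avoids p011 (0 ∷ r) ≡ true
open ZeroOrNewMax

zeroOrNewMax-zero : ∀ {r M} → ZeroOrNewMax r M → admissible p011 r 0 ≡ true
zeroOrNewMax-zero {r} zm = admissible-intro p011 r 0 z≤n (avoids-snoc p011 (0 ∷ r) 0 (avoiding011 zm) no-occurrence)
  where
  no-occurrence : ∀ s' → Sub s' (0 ∷ r) → orderIso (snoc s' 0) p011 ≡ true → ⊥
  no-occurrence s' q o with occurrence-shape₃ s' 0 0 1 1 o
  ... | (y , z , refl , o') with iso011-sound y z 0 o'
  ...   | (() , refl)

zeroOrNewMax-new : ∀ {r M} → ZeroOrNewMax r M → admissible p011 r (suc M) ≡ true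
zeroOrNewMax-new {r} {M} zm =
  admissible-intro p011 r (suc M) (≤-reflexive (cong suc (sym (asc-top zm))))
    (avoids-snoc p011 (0 ∷ r) (suc M) (avoiding011 zm) no-occurrence)
  where
  no-occurrence : ∀ s' → Sub s' (0 ∷ r) → orderIso (snoc s' (suc M)) p011 ≡ true → ⊥
  no-occurrence s' q o with occurrence-shape₃ s' (suc M) 0 1 1 o
  ... | (y , z , refl , o') with iso011-sound y z (suc M) o'
  ...   | (_ , refl) = <-irrefl refl (below-top zm (suc M) (pair-snd q))

zeroOrNewMax-only : ∀ {r M} → ZeroOrNewMax r M → ∀ a → admissible p011 r a ≡ true → (a ≡ 0) ⊎ (a ≡ suc M)
zeroOrNewMax-only zm zero _ = inj₁ refl
zeroOrNewMax-only {r} {M} zm (suc a) adm with suc a ≤? M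
... | yes a<M = ⊥-elim (occurrence-blocks p011 (suc a) (keep 0 (all-present zm (suc a) (s≤s z≤n) a<M))
                  (iso011-complete 0 (suc a) (s≤s z≤n)) (admissible-avoids p011 r (suc a) adm))
... | no a≮M = inj₂ (≤-antisym (subst (λ k → suc a ≤ suc k) (asc-top zm) (admissible-asc p011 r (suc a) adm))
                                (≰⇒> a≮M))

zeroOrNewMax-reset : ∀ {r M} → ZeroOrNewMax r M → ZeroOrNewMax (snoc r 0) M
zeroOrNewMax-reset {r} {M} zm = record
  { asc-top = trans (asc-snoc 0 r 0) (trans (+-identityʳ _) (asc-top zm))
  ; below-top = bnd
  ; all-present = λ y 1≤y y≤M → sub-snoc-skip 0 (all-present zm y 1≤y y≤M)
  ; avoiding011 = admissible-avoids p011 r 0 (zeroOrNewMax-zero zm) }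
  where
  bnd : ∀ y → Elem y (0 ∷ snoc r 0) → y ≤ M
  bnd y q with elem-snoc-inv (0 ∷ r) 0 q
  ... | inj₁ q' = below-top zm y q'
  ... | inj₂ refl = z≤n

zeroOrNewMax-grow : ∀ {r M} → ZeroOrNewMax r M → ZeroOrNewMax (snoc r (suc M)) (suc M)
zeroOrNewMax-grow {r} {M} zm = record
  { asc-top = trans (asc-snoc 0 r (suc M)) new-ascent
  ; below-top = bnd
  ; all-present = present
  ; avoiding011 = admissible-avoids p011 r (suc M) (zeroOrNewMax-new zm) }
  where
  new-ascent : asc (0 ∷ r) + (if lastL 0 r <ᵇ suc M then 1 else 0) ≡ suc M
  new-ascent rewrite <ᵇ-true (s≤s (below-top zm _ (lastL-elem 0 r))) | asc-top zm = +-comm M 1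
  bnd : ∀ y → Elem y (0 ∷ snoc r (suc M)) → y ≤ suc M
  bnd y q with elem-snoc-inv (0 ∷ r) (suc M) q
  ... | inj₁ q' = m≤n⇒m≤1+n (below-top zm y q')
  ... | inj₂ refl = ≤-refl
  present : ∀ y → 1 ≤ y → y ≤ suc M → Elem y (snoc r (suc M))
  present y 1≤y y≤ with m≤n⇒m<n∨m≡n y≤
  ... | inj₁ (s≤s y≤M) = sub-snoc-skip (suc M) (all-present zm y 1≤y y≤M)
  ... | inj₂ refl = elem-last r (suc M)

newMaxAfter : ℕ → ℕ → ℕ
newMaxAfter M zero = M
newMaxAfter M (suc a) = suc a

scheme011 : CountingScheme p011
scheme011 = record
  { State = ℕ
  ; Inv = ZeroOrNewMax
  ; next = newMaxAfter
  ; N = λ j _ → 2 ^ j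
  ; inv-avoids = avoiding011
  ; inv-next = step
  ; N-zero = λ _ → refl
  ; N-suc = λ {r} zm j m room →
      doubling p011 r j m (λ ()) (zeroOrNewMax-zero zm) (zeroOrNewMax-new zm) (zeroOrNewMax-only zm) room }
  where
  step : ∀ {r M a} → ZeroOrNewMax r M → admissible p011 r a ≡ true → ZeroOrNewMax (snoc r a) (newMaxAfter M a)
  step {r} {M} {a} zm adm with zeroOrNewMax-only zm a adm
  ... | inj₁ refl = zeroOrNewMax-reset zm
  ... | inj₂ refl = zeroOrNewMax-grow zm

zeroOrNewMax-start : ZeroOrNewMax [] 0
zeroOrNewMax-start = record
  { asc-top = refl
  ; below-top = λ y q → ≤-reflexive (elem-zero q)
  ; all-present = λ { y (s≤s _) () }
  ; avoiding011 = refl }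

-- Pattern 001.  While no letter has been repeated, an avoider is 0 1 … k and
-- every letter up to k + 1 is admissible.  Once a letter v has been repeated
-- (the smallest repeated letter is then the last one), every later letter must
-- be at most the previous one, so the rest is weakly decreasing.  The
-- continuation counts are therefore:

-- weakly decreasing words of length j with letters at most v,
decreasing : ℕ → ℕ → ℕ
decreasing zero v = 1
decreasing (suc j) v = σ (decreasing j) (suc v)

-- continuations of length j of the repetition-free prefix 0 1 … k.
freshCount : ℕ → ℕ → ℕ
freshCount zero k = 1
freshCount (suc j) k = σ (decreasing j) (suc k) + freshCount j (suc k)

decreasing-zero : ∀ j → decreasing j 0 ≡ 1
decreasing-zero zero = refl
decreasing-zero (suc j) = cong (_+ 0) (decreasing-zero j)

freshCount-step : ∀ j k → freshCount (suc j) (suc k) ≡ freshCount (suc j) k + freshCount j (suc k)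
freshCount-step zero k = cong (_+ 1) (σ-snoc (decreasing 0) (suc k))
freshCount-step (suc j) k = begin
  σ (decreasing (suc j)) (suc (suc k)) + freshCount (suc j) (suc (suc k))
    ≡⟨ cong₂ _+_ (σ-snoc (decreasing (suc j)) (suc k)) (freshCount-step j (suc k)) ⟩
  (σ (decreasing (suc j)) (suc k) + decreasing (suc j) (suc k)) +
    (freshCount (suc j) (suc k) + freshCount j (suc (suc k)))
    ≡⟨ interchange (σ (decreasing (suc j)) (suc k)) (decreasing (suc j) (suc k))
                   (freshCount (suc j) (suc k)) (freshCount j (suc (suc k))) ⟩
  (σ (decreasing (suc j)) (suc k) + freshCount (suc j) (suc k)) +
    (decreasing (suc j) (suc k) + freshCount j (suc (suc k))) ∎
  where open ≡-Reasoning

freshCount-powers : ∀ j → (freshCount j 0 ≡ 2 ^ j) × (freshCount j 1 + 1 ≡ 2 ^ suc j)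
freshCount-powers zero = refl , refl
freshCount-powers (suc j) = from-empty , from-01
  where
  open ≡-Reasoning
  from-empty : freshCount (suc j) 0 ≡ 2 ^ suc j
  from-empty = begin
    (decreasing j 0 + 0) + freshCount j 1 ≡⟨ cong (λ d → (d + 0) + freshCount j 1) (decreasing-zero j) ⟩
    1 + freshCount j 1                    ≡⟨ +-comm 1 (freshCount j 1) ⟩
    freshCount j 1 + 1                    ≡⟨ proj₂ (freshCount-powers j) ⟩
    2 ^ suc j                             ∎
  from-01 : freshCount (suc j) 1 + 1 ≡ 2 ^ suc (suc j)
  from-01 = begin
    freshCount (suc j) 1 + 1                    ≡⟨ cong (_+ 1) (freshCount-step j 0) ⟩
    (freshCount (suc j) 0 + freshCount j 1) + 1 ≡⟨ +-assoc (freshCount (suc j) 0) (freshCount j 1) 1 ⟩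
    freshCount (suc j) 0 + (freshCount j 1 + 1) ≡⟨ cong₂ _+_ from-empty (proj₂ (freshCount-powers j)) ⟩
    2 ^ suc j + 2 ^ suc j                       ≡⟨ cong (2 ^ suc j +_) (sym (+-identityʳ (2 ^ suc j))) ⟩
    2 ^ suc (suc j)                             ∎

data Phase001 : Set where
  distinct : ℕ → Phase001
  repeated : ℕ → ℕ → Phase001

record Distinct (r : List ℕ) (k : ℕ) : Set where
  field
    d-asc       : asc (0 ∷ r) ≡ k
    d-bounded   : ∀ y → Elem y (0 ∷ r) → y ≤ k
    d-present   : ∀ w → w ≤ k → Elem w (0 ∷ r)
    d-no-repeat : ∀ y → Sub (y ∷ y ∷ []) (0 ∷ r) → ⊥
    d-last      : lastL 0 r ≡ k
    d-avoids    : avoids p001 (0 ∷ r) ≡ true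
open Distinct

record Repeated (r : List ℕ) (v k : ℕ) : Set where
  field
    r-asc        : asc (0 ∷ r) ≡ k
    r-v≤k        : v ≤ k
    r-present    : ∀ w → w ≤ k → Elem w (0 ∷ r)
    r-repeats-≥v : ∀ y → Sub (y ∷ y ∷ []) (0 ∷ r) → v ≤ y
    r-v-repeated : Sub (v ∷ v ∷ []) (0 ∷ r)
    r-last       : lastL 0 r ≡ v
    r-avoids     : avoids p001 (0 ∷ r) ≡ true
open Repeated

Inv001 : List ℕ → Phase001 → Set
Inv001 r (distinct k) = Distinct r k
Inv001 r (repeated v k) = Repeated r v k

-- After a repetition-free prefix every letter up to asc + 1 is admissible, since
-- an occurrence of 001 needs a repeated letter.
distinct-free : ∀ {r k} → Distinct r k → ∀ a → a ≤ suc k → admissible p001 r a ≡ true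
distinct-free {r} d a a≤ =
  admissible-intro p001 r a (subst (λ x → a ≤ suc x) (sym (d-asc d)) a≤)
    (avoids-snoc p001 (0 ∷ r) a (d-avoids d) no-occurrence)
  where
  no-occurrence : ∀ s' → Sub s' (0 ∷ r) → orderIso (snoc s' a) p001 ≡ true → ⊥
  no-occurrence s' q o with occurrence-shape₃ s' a 0 0 1 o
  ... | (y , z , refl , o') with iso001-sound y z a o'
  ...   | (refl , _) = d-no-repeat d y q

distinct-admissible-≤ : ∀ {r k} → Distinct r k → ∀ a → admissible p001 r a ≡ true → a ≤ suc k
distinct-admissible-≤ {r} d a adm = subst (λ x → a ≤ suc x) (d-asc d) (admissible-asc p001 r a adm)

-- After a repetition v v, a letter a is admissible iff a ≤ v (a > v gives v v a).
repeated-free : ∀ {r v k} → Repeated r v k → ∀ a → a ≤ v → admissible p001 r a ≡ true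
repeated-free {r} rp a a≤v =
  admissible-intro p001 r a (subst (λ x → a ≤ suc x) (sym (r-asc rp)) (m≤n⇒m≤1+n (≤-trans a≤v (r-v≤k rp))))
    (avoids-snoc p001 (0 ∷ r) a (r-avoids rp) no-occurrence)
  where
  no-occurrence : ∀ s' → Sub s' (0 ∷ r) → orderIso (snoc s' a) p001 ≡ true → ⊥
  no-occurrence s' q o with occurrence-shape₃ s' a 0 0 1 o
  ... | (y , z , refl , o') with iso001-sound y z a o'
  ...   | (refl , y<a) = <⇒≱ y<a (≤-trans a≤v (r-repeats-≥v rp y q))

repeated-admissible-≤ : ∀ {r v k} → Repeated r v k → ∀ a → admissible p001 r a ≡ true → a ≤ v
repeated-admissible-≤ {r} {v} rp a adm with a ≤? v
... | yes a≤v = a≤v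
... | no a≰v = ⊥-elim (occurrence-blocks p001 a (r-v-repeated rp) (iso001-complete v a (≰⇒> a≰v))
                 (admissible-avoids p001 r a adm))

distinct-grow : ∀ {r k} → Distinct r k → Distinct (snoc r (suc k)) (suc k)
distinct-grow {r} {k} d = record
  { d-asc = trans (asc-snoc 0 r (suc k)) new-ascent
  ; d-bounded = bnd
  ; d-present = present
  ; d-no-repeat = no-repeat
  ; d-last = lastL-snoc 0 r (suc k)
  ; d-avoids = admissible-avoids p001 r (suc k) (distinct-free d (suc k) ≤-refl) }
  where
  new-ascent : asc (0 ∷ r) + (if lastL 0 r <ᵇ suc k then 1 else 0) ≡ suc k
  new-ascent rewrite d-last d | <ᵇ-true (n<1+n k) | d-asc d = +-comm k 1
  bnd : ∀ y → Elem y (0 ∷ snoc r (suc k)) → y ≤ suc k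
  bnd y q with elem-snoc-inv (0 ∷ r) (suc k) q
  ... | inj₁ q' = m≤n⇒m≤1+n (d-bounded d y q')
  ... | inj₂ refl = ≤-refl
  present : ∀ w → w ≤ suc k → Elem w (0 ∷ snoc r (suc k))
  present w w≤ with m≤n⇒m<n∨m≡n w≤
  ... | inj₁ (s≤s w≤k) = sub-snoc-skip (suc k) (d-present d w w≤k)
  ... | inj₂ refl = elem-last (0 ∷ r) (suc k)
  no-repeat : ∀ y → Sub (y ∷ y ∷ []) (0 ∷ snoc r (suc k)) → ⊥
  no-repeat y q with pair-snoc-inv (0 ∷ r) (suc k) q
  ... | inj₁ q' = d-no-repeat d y q'
  ... | inj₂ (q' , refl) = <-irrefl refl (d-bounded d _ q')

distinct-repeat : ∀ {r k} → Distinct r k → ∀ a → a ≤ k → Repeated (snoc r a) a k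
distinct-repeat {r} {k} d a a≤k = record
  { r-asc = trans (asc-snoc 0 r a) no-new-ascent
  ; r-v≤k = a≤k
  ; r-present = λ w w≤k → sub-snoc-skip a (d-present d w w≤k)
  ; r-repeats-≥v = repeats
  ; r-v-repeated = sub-snoc-keep a (d-present d a a≤k)
  ; r-last = lastL-snoc 0 r a
  ; r-avoids = admissible-avoids p001 r a (distinct-free d a (m≤n⇒m≤1+n a≤k)) }
  where
  no-new-ascent : asc (0 ∷ r) + (if lastL 0 r <ᵇ a then 1 else 0) ≡ k
  no-new-ascent rewrite d-last d | <ᵇ-false a≤k | d-asc d = +-identityʳ k
  repeats : ∀ y → Sub (y ∷ y ∷ []) (0 ∷ snoc r a) → a ≤ y
  repeats y q with pair-snoc-inv (0 ∷ r) a q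
  ... | inj₁ q' = ⊥-elim (d-no-repeat d y q')
  ... | inj₂ (_ , refl) = ≤-refl

repeated-step : ∀ {r v k} → Repeated r v k → ∀ a → a ≤ v → Repeated (snoc r a) a k
repeated-step {r} {v} {k} rp a a≤v = record
  { r-asc = trans (asc-snoc 0 r a) no-new-ascent
  ; r-v≤k = ≤-trans a≤v (r-v≤k rp)
  ; r-present = λ w w≤k → sub-snoc-skip a (r-present rp w w≤k)
  ; r-repeats-≥v = repeats
  ; r-v-repeated = sub-snoc-keep a (r-present rp a (≤-trans a≤v (r-v≤k rp)))
  ; r-last = lastL-snoc 0 r a
  ; r-avoids = admissible-avoids p001 r a (repeated-free rp a a≤v) }
  where
  no-new-ascent : asc (0 ∷ r) + (if lastL 0 r <ᵇ a then 1 else 0) ≡ k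
  no-new-ascent rewrite r-last rp | <ᵇ-false a≤v | r-asc rp = +-identityʳ k
  repeats : ∀ y → Sub (y ∷ y ∷ []) (0 ∷ snoc r a) → a ≤ y
  repeats y q with pair-snoc-inv (0 ∷ r) a q
  ... | inj₁ q' = ≤-trans a≤v (r-repeats-≥v rp y q')
  ... | inj₂ (_ , refl) = ≤-refl

next001 : Phase001 → ℕ → Phase001
next001 (distinct k) a = if a ≤ᵇ k then repeated a k else distinct a
next001 (repeated v k) a = repeated a k

N001 : ℕ → Phase001 → ℕ
N001 j (distinct k) = freshCount j k
N001 j (repeated v k) = decreasing j v

inv001-next : ∀ {r s a} → Inv001 r s → admissible p001 r a ≡ true → Inv001 (snoc r a) (next001 s a)
inv001-next {r} {distinct k} {a} d adm with m≤n⇒m<n∨m≡n (distinct-admissible-≤ d a adm)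
... | inj₁ (s≤s a≤k) rewrite ≤ᵇ-true a≤k = distinct-repeat d a a≤k
... | inj₂ refl rewrite ≤ᵇ-false (n<1+n k) = distinct-grow d
inv001-next {r} {repeated v k} {a} rp adm = repeated-step rp a (repeated-admissible-≤ rp a adm)

distinct-sum : ∀ {r k} → Distinct r k → ∀ j m → suc (suc (length r)) ≤ m →
  σ (λ a → if admissible p001 r a then N001 j (next001 (distinct k) a) else 0) m ≡ freshCount (suc j) k
distinct-sum {r} {k} d j m room = begin
  σ (λ a → if admissible p001 r a then N001 j (next001 (distinct k) a) else 0) m
    ≡⟨ σ-ext m split ⟩
  σ (λ a → (if a ≤ᵇ k then decreasing j a else 0) + (if a ≡ᵇ suc k then freshCount j (suc k) else 0)) m
    ≡⟨ σ-+ _ _ m ⟩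
  σ (λ a → if a ≤ᵇ k then decreasing j a else 0) m + σ (λ a → if a ≡ᵇ suc k then freshCount j (suc k) else 0) m
    ≡⟨ cong₂ _+_ (σ-prefix (decreasing j) k m (<-≤-trans (s≤s (m≤n⇒m≤1+n k≤len)) room))
                 (σ-point (suc k) (freshCount j (suc k)) m (<-≤-trans (s≤s (s≤s k≤len)) room)) ⟩
  σ (decreasing j) (suc k) + freshCount j (suc k) ∎
  where
  open ≡-Reasoning
  k≤len : k ≤ length r
  k≤len = subst (_≤ length r) (d-asc d) (asc-≤-length 0 r)
  split : ∀ a → (if admissible p001 r a then N001 j (next001 (distinct k) a) else 0) ≡
                (if a ≤ᵇ k then decreasing j a else 0) + (if a ≡ᵇ suc k then freshCount j (suc k) else 0)
  split a with admissible p001 r a in adm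
  ... | true with m≤n⇒m<n∨m≡n (distinct-admissible-≤ d a adm)
  ...   | inj₁ (s≤s a≤k) rewrite ≤ᵇ-true a≤k | ≡ᵇ-false {a} {suc k} (λ e → <-irrefl e (s≤s a≤k)) =
          sym (+-identityʳ _)
  ...   | inj₂ refl rewrite ≤ᵇ-false (n<1+n k) | ≡ᵇ-refl (suc k) = refl
  split a | false with a ≤? suc k
  ...   | yes a≤ = ⊥-elim (true≢false (trans (sym (distinct-free d a a≤)) adm))
  ...   | no a≰ rewrite ≤ᵇ-false {a} {k} (<-trans (n<1+n k) (≰⇒> a≰))
                      | ≡ᵇ-false {a} {suc k} (λ e → <-irrefl (sym e) (≰⇒> a≰)) = refl

repeated-sum : ∀ {r v k} → Repeated r v k → ∀ j m → suc (suc (length r)) ≤ m →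
  σ (λ a → if admissible p001 r a then N001 j (next001 (repeated v k) a) else 0) m ≡ decreasing (suc j) v
repeated-sum {r} {v} {k} rp j m room =
  trans (σ-ext m split) (σ-prefix (decreasing j) v m (<-≤-trans (s≤s (m≤n⇒m≤1+n v≤len)) room))
  where
  v≤len : v ≤ length r
  v≤len = ≤-trans (r-v≤k rp) (subst (_≤ length r) (r-asc rp) (asc-≤-length 0 r))
  split : ∀ a → (if admissible p001 r a then decreasing j a else 0) ≡ (if a ≤ᵇ v then decreasing j a else 0)
  split a with admissible p001 r a in adm
  ... | true rewrite ≤ᵇ-true (repeated-admissible-≤ rp a adm) = refl
  ... | false with a ≤? v
  ...   | yes a≤v = ⊥-elim (true≢false (trans (sym (repeated-free rp a a≤v)) adm))
  ...   | no a≰v rewrite ≤ᵇ-false (≰⇒> a≰v) = refl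

scheme001 : CountingScheme p001
scheme001 = record
  { State = Phase001
  ; Inv = Inv001
  ; next = next001
  ; N = N001
  ; inv-avoids = λ { {s = distinct k} d → d-avoids d ; {s = repeated v k} rp → r-avoids rp }
  ; inv-next = inv001-next
  ; N-zero = λ { (distinct k) → refl ; (repeated v k) → refl }
  ; N-suc = λ { {s = distinct k} d → distinct-sum d ; {s = repeated v k} rp → repeated-sum rp } }

distinct-start : Distinct [] 0
distinct-start = record
  { d-asc = refl
  ; d-bounded = λ y q → ≤-reflexive (elem-zero q)
  ; d-present = λ { zero z≤n → keep 0 nil }
  ; d-no-repeat = λ { y (keep .0 ()) ; y (skip .0 ()) }
  ; d-last = refl
  ; d-avoids = refl }

count10 : ∀ j → numAvoiding p10 (suc j) ≡ 2 ^ j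
count10 = scheme-count (staircaseScheme p10 admissibility10) 0 (staircase-start p10 refl)

count010 : ∀ j → numAvoiding p010 (suc j) ≡ 2 ^ j
count010 = scheme-count (staircaseScheme p010 admissibility010) 0 (staircase-start p010 refl)

count012 : ∀ j → numAvoiding p012 (suc j) ≡ 2 ^ j
count012 = scheme-count scheme012 tt zeroOne-start

count011 : ∀ j → numAvoiding p011 (suc j) ≡ 2 ^ j
count011 = scheme-count scheme011 0 zeroOrNewMax-start

count001 : ∀ j → numAvoiding p001 (suc j) ≡ 2 ^ j
count001 j = trans (scheme-count scheme001 (distinct 0) distinct-start j) (proj₁ (freshCount-powers j))

corollary2p3 : WilfEquiv (1 ∷ 0 ∷ []) (0 ∷ 0 ∷ 1 ∷ [])
    × WilfEquiv (1 ∷ 0 ∷ []) (0 ∷ 1 ∷ 0 ∷ [])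
    × WilfEquiv (1 ∷ 0 ∷ []) (0 ∷ 1 ∷ 1 ∷ [])
    × WilfEquiv (1 ∷ 0 ∷ []) (0 ∷ 1 ∷ 2 ∷ [])
corollary2p3 =
    (λ { (suc j) _ → trans (count10 j) (sym (count001 j)) })
  , (λ { (suc j) _ → trans (count10 j) (sym (count010 j)) })
  , (λ { (suc j) _ → trans (count10 j) (sym (count011 j)) })
  , (λ { (suc j) _ → trans (count10 j) (sym (count012 j)) })
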